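{- Let $A$ be a partial combinatory algebra over $\omega$ with its ${\Pi}{\Sigma}\mathrm{I}$ (respectively ${\Pi}{\Sigma}\mathrm{W}\mathrm{I}$) type structure. Let $\sigma\sim\tau$ and let $a,b$ have type $\sigma$. Then: if there are $c,d\in A$ with $c=d\Vdash a^\sigma=b^\tau$, then $a\sim_\sigma b$; and if $a\sim_\sigma b$, then $a^\sigma=b^\tau$ (as sets).
   Context: Work in ${\sf CZF}$ (${\sf CZF}+{\sf REA}$ for ${\Pi}{\Sigma}\mathrm{W}\mathrm{I}$). Pca over $\omega$: set $A$ with at least two elements, partial application $ab$ (left-associated), $\mathbf k,\mathbf s$ with $\mathbf kab\simeq a$, $\mathbf sab\downarrow$, $\mathbf sabc\simeq ac(bc)$; numerals $n\mapsto\bar n$ and $\mathbf{succ},\mathbf{pred},\mathbf d$ with $\mathbf{succ}\,\bar n=\overline{n+1}$, $\mathbf{pred}\,\overline{n+1}=\bar n$, $\mathbf d\bar n\bar mab\simeq a$ if $n=m$ else $b$; $\mathbf0=\bar0,\mathbf1=\bar1$; pairing $\mathbf p,\mathbf p_0,\mathbf p_1$ with $\mathbf p_i(\mathbf pa_0a_1)=a_i$, $a_i:=\mathbf p_ia$. Type codes ${\sf N}_n=\mathbf p\bar0\bar n$, ${\sf N}=\mathbf p\bar1\mathbf0$, ${\Pi}_ab=\mathbf p\bar2(\mathbf pab)$, ${\Sigma}_ab=\mathbf p\bar3(\mathbf pab)$, $\mathrm{I}_c(a,b)=\mathbf p\bar4(\mathbf pc(\mathbf pab))$, $\mathrm{W}_ab=\mathbf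 p\bar5(\mathbf pab)$. Type structure (simultaneous inductive definition of $\sim$ and $\sim_\sigma$): ${\sf N}_n\sim{\sf N}_n$, $a\sim_{{\sf N}_n}b$ iff $a=b=\bar m$, $m<n$; ${\sf N}\sim{\sf N}$, $a\sim_{\sf N}b$ iff $a=b=\bar n$, $n\in\omega$; if $\sigma\sim\tau$ and ($a\sim_\sigma b\Rightarrow ia\sim jb$) then ${\Pi}_\sigma i\sim{\Pi}_\tau j$ with $f\sim_{{\Pi}_\sigma i}g$ iff ($a\sim_\sigma b\Rightarrow fa\sim_{ia}gb$), and ${\Sigma}_\sigma i\sim{\Sigma}_\tau j$ with $a\sim_{{\Sigma}_\sigma i}b$ iff $a_0\sim_\sigma b_0$ and $a_1\sim_{ia_0}b_1$; if $\sigma\sim\tau$, $a\sim_\sigma\breve a$, $b\sim_\sigma\breve b$ then $\mathrm{I}_\sigma(a,b)\sim\mathrm{I}_\tau(\breve a,\breve b)$ with $c\sim_{\mathrm{I}_\sigma(a,b)}d$ iff $c=d=\mathbf0$ and $a\sim_\sigma b$; for ${\Pi}{\Sigma}\mathrm{W}\mathrm{I}$ also: if $\sigma\sim\tau$ and ($a\sim_\sigma b\Rightarrow ia\sim jb$) then $\mathrm{W}_\sigma i\sim\mathrm{W}_\tau j$ with $\sim_{\mathrm{W}_\sigma i}$ the least relation such that $c\sim d$ whenever $c_0\sim_\sigma d_0$ and $c_1p\sim d_1q$ for all $p\sim_{ic_0}q$. $\sigma$ is a type if $\sigma\sim\sigma$; $a$ has type $\sigma$ if $a\sim_\sigma a$;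 $i$ is a family of types over $\sigma$ if $a\sim_\sigma b$ implies $ia\sim ib$. $\mathrm{V_{ext}}(A)$ is the least class with $x\in\mathrm{V_{ext}}(A)$ whenever $x\subseteq A\times A\times\mathrm{V_{ext}}(A)$. Internal pairing: $\{x\}_A=\{\langle\mathbf0,\mathbf0,x\rangle\}$, $\{x,y\}_A=\{\langle\mathbf0,\mathbf0,x\rangle,\langle\mathbf1,\mathbf1,y\rangle\}$, $\langle x,y\rangle_A=\{\langle\mathbf0,\mathbf0,\{x\}_A\rangle,\langle\mathbf1,\mathbf1,\{x,y\}_A\rangle\}$. For $n\in\omega$, $\dot n=\{\langle\bar m,\bar m,\dot m\rangle\mid m<n\}$. For $a$ of type $\sigma$, $a^\sigma\in\mathrm{V_{ext}}(A)$ is defined by induction on types: if $\sigma={\sf N}_n$ or ${\sf N}$ and $a=\bar m$, $a^\sigma=\dot m$; $f^{{\Pi}_\sigma i}=\{\langle a,b,\langle a^\sigma,(fa)^{ia}\rangle_A\rangle\mid a\sim_\sigma b\}$; $a^{{\Sigma}_\sigma i}=\langle (a_0)^\sigma,(a_1)^{ia_0}\rangle_A$; $c^{\mathrm{I}_\sigma(a,b)}=0$ (the empty set); $c^{\mathrm{W}_\sigma i}=\langle (c_0)^\sigma,\{\langle p,q,\langle p^{ic_0},(c_1p)^{\mathrm{W}_\sigma i}\rangle_A\rangle\mid p\sim_{ic_0}q\}\rangle_A$. Extensional realizability $a=b\Vdash\varphi$ ($a,b\in A$, $\varphi$ a set-theoretic formula with parameters in $\mathrm{V_{ext}}(A)$;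 terms appearing are required to be defined): $a=b\Vdash x\in y$ iff $\exists z(\langle a_0,b_0,z\rangle\in y\wedge a_1=b_1\Vdash x=z)$; $a=b\Vdash x=y$ iff for all $\langle c,d,z\rangle\in x$, $(ac)_0=(bd)_0\Vdash z\in y$ and for all $\langle c,d,z\rangle\in y$, $(ac)_1=(bd)_1\Vdash z\in x$; $\wedge$: componentwise on $a_0,b_0$ and $a_1,b_1$; $\vee$: $a_0=b_0=\mathbf0$ and $a_1=b_1\Vdash\varphi$, or $a_0=b_0=\mathbf1$ and $a_1=b_1\Vdash\psi$; $\neg\varphi$: no $c,d$ with $c=d\Vdash\varphi$; $\varphi\to\psi$: $c=d\Vdash\varphi$ implies $ac=bd\Vdash\psi$; $\forall x\in y\,\varphi$: $ac=bd\Vdash\varphi$ for all $\langle c,d,x\rangle\in y$; $\exists x\in y\,\varphi$: $\exists x(\langle a_0,b_0,x\rangle\in y\wedge a_1=b_1\Vdash\varphi)$; $\forall x\varphi$ / $\exists x\varphi$: for all / some $x\in\mathrm{V_{ext}}(A)$, $a=b\Vdash\varphi$. -}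

module Defs where

open import Data.Nat using (ℕ; zero; suc; _<_)
open import Data.Bool using (Bool; true; false; if_then_else_)
open import Data.Empty using (⊥)
open import Data.Unit using (⊤; tt)
open import Data.Maybe using (Maybe; just; nothing; maybe)
open import Data.Product using (Σ; _×_; _,_)
open import Relation.Binary.PropositionalEquality using (_≡_; _≢_)

-- Partial applicative structure: a set A with a partial binary
-- application, given as a functional relation  App a b c  ("a b ≃ c").

record PAS : Set₁ where
  field
    A   : Set
    App : A → A → A → Set
    App-functional : ∀ {a b c c'} → App a b c → App a b c' → c ≡ c'

module Terms (P : PAS) where
  open PAS P

  infixl 7 _∙_
  data Tm : Set where
    ‘_  : A → Tm
    _∙_ : Tm → Tm → Tm

  infix 4 _⇓_
  data _⇓_ : Tm → A → Set where
    ⇓con : ∀ {a} → (‘ a) ⇓ a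
    ⇓app : ∀ {t u f x v} → t ⇓ f → u ⇓ x → App f x v → (t ∙ u) ⇓ v

  Defined : Tm → Set
  Defined t = Σ A (λ v → t ⇓ v)

  infix 4 _≃_
  _≃_ : Tm → Tm → Set
  t ≃ u = ∀ v → ((t ⇓ v → u ⇓ v) × (u ⇓ v → t ⇓ v))

record PCA (P : PAS) : Set where
  open PAS P
  open Terms P
  field
    two   : Σ A (λ x → Σ A (λ y → x ≢ y))
    k s   : A
    k-ax  : ∀ a b → (‘ k ∙ ‘ a ∙ ‘ b) ≃ ‘ a
    s-def : ∀ a b → Defined (‘ s ∙ ‘ a ∙ ‘ b)
    s-ax  : ∀ a b c → (‘ s ∙ ‘ a ∙ ‘ b ∙ ‘ c) ≃ (‘ a ∙ ‘ c ∙ (‘ b ∙ ‘ c))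
    num   : ℕ → A
    succ pred d : A
    succ-ax : ∀ n → (‘ succ ∙ ‘ num n) ⇓ num (suc n)
    pred-ax : ∀ n → (‘ pred ∙ ‘ num (suc n)) ⇓ num n
    d-eq  : ∀ n a b → (‘ d ∙ ‘ num n ∙ ‘ num n ∙ ‘ a ∙ ‘ b) ≃ ‘ a
    d-neq : ∀ n m a b → n ≢ m → (‘ d ∙ ‘ num n ∙ ‘ num m ∙ ‘ a ∙ ‘ b) ≃ ‘ b
    p p₀ p₁ : A
    p₀-ax : ∀ a b → (‘ p₀ ∙ (‘ p ∙ ‘ a ∙ ‘ b)) ⇓ a
    p₁-ax : ∀ a b → (‘ p₁ ∙ (‘ p ∙ ‘ a ∙ ‘ b)) ⇓ b

-- Generic W-relation: the least relation R_W such that  c R_W e  whenever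
-- c₀ R e₀ and c₁p R_W e₁q for all p (B c₀ e₀ h) q.
-- (Parameterised by the projections, so defined outside the universe.)

module WRelation (P : PAS) (π₀ π₁ : PAS.A P) where
  open PAS P

  data WR (R : A → A → Set) (B : (c₀ e₀ : A) → R c₀ e₀ → A → A → Set)
          : A → A → Set where
    wsup : ∀ {c e} (c₀ c₁ e₀ e₁ : A)
         → App π₀ c c₀ → App π₁ c c₁ → App π₀ e e₀ → App π₁ e e₁
         → (h : R c₀ e₀)
         → (∀ q r → B c₀ e₀ h q r →
              Σ A (λ cq → Σ A (λ er → App c₁ q cq × App e₁ r er × WR R B cq er)))
         → WR R B c e

-- The type structure, V_ext(A), the interpretation a^σ and extensional
-- realizability.  withW = false : ΠΣI ;  withW = true : ΠΣWI.

module TS (P : PAS) (C : PCA P) (withW : Bool) where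
  open PAS P public
  open Terms P public
  open PCA C public
  open WRelation P p₀ p₁ public

  -- the value of  p a b  (defined, by the pairing axiom)
  private
    inner : ∀ {t u v} → (t ∙ u) ⇓ v → A
    inner (⇓app {x = x} _ _ _) = x

  pair : A → A → A
  pair a b = inner (p₀-ax a b)

  𝟎 𝟏 : A
  𝟎 = num 0
  𝟏 = num 1

  N-code : ℕ → A
  N-code n = pair (num 0) (num n)
  Nω-code : A
  Nω-code = pair (num 1) 𝟎
  Π-code Σ-code W-code : A → A → A
  Π-code a b = pair (num 2) (pair a b)
  Σ-code a b = pair (num 3) (pair a b)
  W-code a b = pair (num 5) (pair a b)
  I-code : A → A → A → A
  I-code c a b = pair (num 4) (pair c (pair a b))

  mutual
    infix 4 _∼_
    data _∼_ : A → A → Set where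
      ∼N  : (n : ℕ) → N-code n ∼ N-code n
      ∼Nω : Nω-code ∼ Nω-code
      ∼Π  : ∀ {σ τ i j} (D : σ ∼ τ) (F : (a b : A) → El D a b → Fam i j a b)
          → Π-code σ i ∼ Π-code τ j
      ∼Σ  : ∀ {σ τ i j} (D : σ ∼ τ) (F : (a b : A) → El D a b → Fam i j a b)
          → Σ-code σ i ∼ Σ-code τ j
      ∼I  : ∀ {σ τ a a' b b'} (D : σ ∼ τ) → El D a a' → El D b b'
          → I-code σ a b ∼ I-code τ a' b'
      ∼W  : withW ≡ true
          → ∀ {σ τ i j} (D : σ ∼ τ) (F : (a b : A) → El D a b → Fam i j a b)
          → W-code σ i ∼ W-code τ j

    data Fam (i j a b : A) : Set where
      fam : (ia jb : A) → App i a ia → App j b jb → ia ∼ jb → Fam i j a b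

    ElF : ∀ {i j a b} → Fam i j a b → A → A → Set
    ElF (fam _ _ _ _ T) x y = El T x y

    ElΠ : ∀ {i j a b} → Fam i j a b → A → A → Set
    ElΠ {a = a} {b = b} (fam _ _ _ _ T) f g =
      Σ A (λ fa → Σ A (λ gb → App f a fa × App g b gb × El T fa gb))

    -- the relation ∼_σ
    El : ∀ {σ τ} → σ ∼ τ → A → A → Set
    El (∼N n) a b = Σ ℕ (λ m → m < n × a ≡ num m × b ≡ num m)
    El ∼Nω a b = Σ ℕ (λ m → a ≡ num m × b ≡ num m)
    El (∼Π D F) f g = ∀ a b → (h : El D a b) → ElΠ (F a b h) f g
    El (∼Σ D F) c e =
      Σ A (λ c₀ → Σ A (λ c₁ → Σ A (λ e₀ → Σ A (λ e₁ →
        App p₀ c c₀ × App p₁ c c₁ × App p₀ e e₀ × App p₁ e e₁ ×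
        Σ (El D c₀ e₀) (λ h → ElF (F c₀ e₀ h) c₁ e₁)))))
    El (∼I {a = a} {b = b} D _ _) c e = c ≡ 𝟎 × e ≡ 𝟎 × El D a b
    El (∼W _ D F) = WR (El D) (λ c₀ e₀ h → ElF (F c₀ e₀ h))

  IsType : A → Set
  IsType σ = σ ∼ σ

  -- V_ext(A): least class with x ∈ V_ext(A) whenever x ⊆ A × A × V_ext(A)
  -- (Aczel-style sets: an index set together with a family of triples).

  data V : Set₁ where
    sup : (I : Set) → (I → A × A × V) → V

  mutual
    infix 4 _≈_
    _≈_ : V → V → Set
    sup I f ≈ sup J g =
      (∀ i → Σ J (λ j → f i ≈₃ g j)) × (∀ j → Σ I (λ i → f i ≈₃ g j))

    _≈₃_ : A × A × V → A × A × V → Set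
    (a , b , x) ≈₃ (a' , b' , y) = a ≡ a' × b ≡ b' × x ≈ y

  ∅ : V
  ∅ = sup ⊥ (λ ())

  sng : V → V
  sng x = sup ⊤ (λ _ → (𝟎 , 𝟎 , x))

  upair : V → V → V
  upair x y = sup Bool (λ b → if b then (𝟏 , 𝟏 , y) else (𝟎 , 𝟎 , x))

  ⟨_,_⟩A : V → V → V
  ⟨ x , y ⟩A = sup Bool (λ b → if b then (𝟏 , 𝟏 , (upair x y)) else (𝟎 , 𝟎 , (sng x)))

  -- ṅ = {⟨m̄, m̄, ṁ⟩ | m < n}, built by  (n+1)˙ = ṅ ∪ {⟨n̄, n̄, ṅ⟩}
  private
    extend : V → A × A × V → V
    extend (sup I f) t = sup (Maybe I) (maybe f t)

  dot : ℕ → V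
  dot zero = ∅
  dot (suc n) = extend (dot n) (num n , num n , dot n)

  -- a^σ, by recursion on the derivation of σ ∼ τ and on a ∼_σ b.
  -- ⟦ D ⟧ a b h is the set a^σ (it only uses a and σ; b, h are evidence).

  mutual
    ⟦_⟧ : ∀ {σ τ} (D : σ ∼ τ) (a b : A) → El D a b → V
    ⟦ ∼N n ⟧ a b (m , _ , _ , _) = dot m
    ⟦ ∼Nω ⟧ a b (m , _ , _) = dot m
    ⟦ ∼Π D F ⟧ f g hf =
      sup (Σ A (λ a → Σ A (λ b → El D a b)))
          (λ { (a , b , h) → (a , b , ⟨ ⟦ D ⟧ a b h , ⟦Π⟧ (F a b h) f g (hf a b h) ⟩A) })
    ⟦ ∼Σ D F ⟧ c e (c₀ , c₁ , e₀ , e₁ , _ , _ , _ , _ , h , h₁) =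
      ⟨ ⟦ D ⟧ c₀ e₀ h , ⟦F⟧ (F c₀ e₀ h) c₁ e₁ h₁ ⟩A
    ⟦ ∼I _ _ _ ⟧ c e _ = ∅
    ⟦ ∼W _ D F ⟧ c e w = ⟦W⟧ D F w

    ⟦F⟧ : ∀ {i j a b} (φ : Fam i j a b) (x y : A) → ElF φ x y → V
    ⟦F⟧ (fam _ _ _ _ T) x y h = ⟦ T ⟧ x y h

    ⟦Π⟧ : ∀ {i j a b} (φ : Fam i j a b) (f g : A) → ElΠ φ f g → V
    ⟦Π⟧ (fam _ _ _ _ T) f g (fa , gb , _ , _ , h) = ⟦ T ⟧ fa gb h

    ⟦W⟧ : ∀ {σ τ i j} (D : σ ∼ τ) (F : (a b : A) → El D a b → Fam i j a b)
          {c e : A} → WR (El D) (λ c₀ e₀ h → ElF (F c₀ e₀ h)) c e → V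
    ⟦W⟧ D F (wsup c₀ c₁ e₀ e₁ _ _ _ _ h k) =
      ⟨ ⟦ D ⟧ c₀ e₀ h
      , sup (Σ A (λ q → Σ A (λ r → ElF (F c₀ e₀ h) q r)))
            (λ { (q , r , t) → (q , r , ⟨ ⟦F⟧ (F c₀ e₀ h) q r t , ⟦W⟧step D F (k q r t) ⟩A) }) ⟩A

    ⟦W⟧step : ∀ {σ τ i j} (D : σ ∼ τ) (F : (a b : A) → El D a b → Fam i j a b)
              {c₁ e₁ q r : A}
            → Σ A (λ cq → Σ A (λ er → App c₁ q cq × App e₁ r er
                 × WR (El D) (λ c₀ e₀ h → ElF (F c₀ e₀ h)) cq er))
            → V
    ⟦W⟧step D F (_ , _ , _ , _ , w) = ⟦W⟧ D F w

  -- Extensional realizability for atomic formulas  x = y  and  x ∈ y.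
  -- Realize-eq a b x y   :  a = b ⊩ x = y
  -- Realize-mem a b x y  :  a = b ⊩ x ∈ y

  mutual
    Realize-eq : A → A → V → V → Set
    Realize-eq a b x@(sup I f) y@(sup J g) =
      (∀ i → EqStep p₀ a b (f i) y) × (∀ j → EqStep p₁ a b (g j) x)

    EqStep : A → A → A → A × A × V → V → Set
    EqStep π a b (c , d , z) y =
      Σ A (λ ac → Σ A (λ bd → App a c ac × App b d bd ×
        Σ A (λ u → Σ A (λ v → App π ac u × App π bd v × Realize-mem u v z y))))

    Realize-mem : A → A → V → V → Set
    Realize-mem a b x (sup J g) =
      Σ A (λ a₀ → Σ A (λ a₁ → Σ A (λ b₀ → Σ A (λ b₁ →
        App p₀ a a₀ × App p₁ a a₁ × App p₀ b b₀ × App p₁ b b₁ ×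
        Σ J (λ j → MemStep a₀ b₀ a₁ b₁ x (g j))))))

    MemStep : A → A → A → A → V → A × A × V → Set
    MemStep a₀ b₀ a₁ b₁ x (c , d , z) = c ≡ a₀ × d ≡ b₀ × Realize-eq a₁ b₁ x z

-- Type codes are injective pairs tagged by their former, so two
-- derivations whose codes share an end are built by the same former and define
-- the same relation; hence each ∼_σ is a partial equivalence relation depending
-- only on the code.  By induction on derivations, a^σ respects ∼_σ and does not
-- depend on the derivation used to compute it, which gives a^σ = b^τ.  For the
-- converse it is enough to know that a^σ and b^σ have the same elements up to
-- their realizer labels, which is all a realizer of a^σ = b^τ provides: internal
-- pairing and n ↦ ṅ are injective for this weak equality, and by induction on σ
-- it forces a ∼_σ b.

module Submission where

open import Defs
open import Data.Bool using (Bool; true; false)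
open import Data.Empty using (⊥-elim)
open import Data.Maybe using (just; nothing)
open import Data.Nat using (ℕ; zero; suc; _<_; _≤_; z≤n)
open import Data.Nat.Properties using (_≟_; ≤-refl; ≤-antisym; ≤-<-trans; m<n⇒m<1+n)
open import Data.Product using (Σ; _×_; _,_; proj₁; proj₂)
open import Data.Sum using (_⊎_; inj₁; inj₂)
open import Data.Unit using (tt)
open import Relation.Nullary using (yes; no)
open import Relation.Binary.PropositionalEquality
  using (_≡_; refl; sym; trans; cong; subst; subst₂)

module _ (P : PAS) (C : PCA P) (withW : Bool) where
  open TS P C withW

  private variable
    σ τ σ′ τ′ i j i′ j′ : A

  ⇓-deterministic : ∀ {t v v′} → t ⇓ v → t ⇓ v′ → v ≡ v′
  ⇓-deterministic ⇓con ⇓con = refl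
  ⇓-deterministic (⇓app t⇓ u⇓ app) (⇓app t⇓′ u⇓′ app′)
    with ⇓-deterministic t⇓ t⇓′ | ⇓-deterministic u⇓ u⇓′
  ... | refl | refl = App-functional app app′

  p-pair⇓ : ∀ a b → (‘ p ∙ ‘ a ∙ ‘ b) ⇓ pair a b
  p-pair⇓ a b with p₀-ax a b
  ... | ⇓app ⇓con p⇓ _ = p⇓

  p₀-pair : ∀ a b → App p₀ (pair a b) a
  p₀-pair a b with p₀-ax a b
  ... | ⇓app ⇓con _ app = app

  p₁-pair : ∀ a b → App p₁ (pair a b) b
  p₁-pair a b with p₁-ax a b
  ... | ⇓app ⇓con p⇓ app with ⇓-deterministic p⇓ (p-pair⇓ a b)
  ...   | refl = app

  pair-injective : ∀ {a b a′ b′} → pair a b ≡ pair a′ b′ → a ≡ a′ × b ≡ b′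
  pair-injective {a} {b} {a′} {b′} e =
    App-functional (p₀-pair a b) (subst (λ z → App p₀ z a′) (sym e) (p₀-pair a′ b′)) ,
    App-functional (p₁-pair a b) (subst (λ z → App p₁ z b′) (sym e) (p₁-pair a′ b′))

  ‘-⇓-inv : ∀ {a b} → ‘ a ⇓ b → a ≡ b
  ‘-⇓-inv ⇓con = refl

  -- If n̄ = m̄ with n ≠ m, then d n̄ m̄ x y evaluates both to x and to y.
  num-injective : ∀ {n m} → num n ≡ num m → n ≡ m
  num-injective {n} {m} e with n ≟ m | two
  ... | yes n≡m | _ = n≡m
  ... | no n≢m | x , y , x≢y =
    ⊥-elim (x≢y (sym (‘-⇓-inv (proj₁ (d-neq n m x y n≢m x) d⇓x))))
    where
      d⇓x : (‘ d ∙ ‘ num n ∙ ‘ num m ∙ ‘ x ∙ ‘ y) ⇓ x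
      d⇓x = subst (λ z → (‘ d ∙ ‘ num n ∙ ‘ z ∙ ‘ x ∙ ‘ y) ⇓ x) e (proj₂ (d-eq n x y x) ⇓con)

  pick : Bool → A → A → A
  pick false x y = x
  pick true  x y = y

  pick-diag : ∀ s x → pick s x x ≡ x
  pick-diag false x = refl
  pick-diag true  x = refl

  pick-natural : ∀ s (f : A → A → A) {x y x′ y′} →
                 pick s (f x x′) (f y y′) ≡ f (pick s x y) (pick s x′ y′)
  pick-natural false f = refl
  pick-natural true  f = refl

  pick-App : ∀ s {i j x y ix jy} → App i x ix → App j y jy →
             App (pick s i j) (pick s x y) (pick s ix jy)
  pick-App false app _ = app
  pick-App true  _ app = app

  ShareEnd : A → A → A → A → Set
  ShareEnd σ τ σ′ τ′ = Σ Bool λ s → Σ Bool λ s′ → pick s σ τ ≡ pick s′ σ′ τ′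

  ShareEnd-sym : ShareEnd σ τ σ′ τ′ → ShareEnd σ′ τ′ σ τ
  ShareEnd-sym (s , s′ , e) = s′ , s , sym e

  former : σ ∼ τ → ℕ
  former (∼N _)     = 0
  former ∼Nω        = 1
  former (∼Π _ _)   = 2
  former (∼Σ _ _)   = 3
  former (∼I _ _ _) = 4
  former (∼W _ _ _) = 5

  p₀-pick-pair : ∀ s {k x y} → App p₀ (pick s (pair k x) (pair k y)) k
  p₀-pick-pair false = p₀-pair _ _
  p₀-pick-pair true  = p₀-pair _ _

  p₀-code : ∀ (D : σ ∼ τ) s → App p₀ (pick s σ τ) (num (former D))
  p₀-code (∼N _)     s = p₀-pick-pair s
  p₀-code ∼Nω        s = p₀-pick-pair s
  p₀-code (∼Π _ _)   s = p₀-pick-pair s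
  p₀-code (∼Σ _ _)   s = p₀-pick-pair s
  p₀-code (∼I _ _ _) s = p₀-pick-pair s
  p₀-code (∼W _ _ _) s = p₀-pick-pair s

  FamOf : σ ∼ τ → A → A → Set
  FamOf E i j = (a b : A) → El E a b → Fam i j a b

  data SameFormer : σ ∼ τ → σ′ ∼ τ′ → Set where
    N-N : ∀ {n n′} → SameFormer (∼N n) (∼N n′)
    Nω-Nω : SameFormer ∼Nω ∼Nω
    Π-Π : ∀ {E : σ ∼ τ} {F : FamOf E i j} {E′ : σ′ ∼ τ′} {F′ : FamOf E′ i′ j′} →
          SameFormer (∼Π E F) (∼Π E′ F′)
    Σ-Σ : ∀ {E : σ ∼ τ} {F : FamOf E i j} {E′ : σ′ ∼ τ′} {F′ : FamOf E′ i′ j′} →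
          SameFormer (∼Σ E F) (∼Σ E′ F′)
    I-I : ∀ {a a′ b b′ c c′ d d′} {E : σ ∼ τ} {x : El E a a′} {y : El E b b′}
            {E′ : σ′ ∼ τ′} {x′ : El E′ c c′} {y′ : El E′ d d′} →
          SameFormer (∼I E x y) (∼I E′ x′ y′)
    W-W : ∀ {w w′ : withW ≡ true} {E : σ ∼ τ} {F : FamOf E i j}
            {E′ : σ′ ∼ τ′} {F′ : FamOf E′ i′ j′} →
          SameFormer (∼W w E F) (∼W w′ E′ F′)

  same-former : (D : σ ∼ τ) (D′ : σ′ ∼ τ′) → former D ≡ former D′ → SameFormer D D′
  same-former (∼N _)     (∼N _)     _ = N-N
  same-former ∼Nω        ∼Nω        _ = Nω-Nω
  same-former (∼Π _ _)   (∼Π _ _)   _ = Π-Π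
  same-former (∼Σ _ _)   (∼Σ _ _)   _ = Σ-Σ
  same-former (∼I _ _ _) (∼I _ _ _) _ = I-I
  same-former (∼W _ _ _) (∼W _ _ _) _ = W-W
  same-former (∼N _)     ∼Nω        ()
  same-former (∼N _)     (∼Π _ _)   ()
  same-former (∼N _)     (∼Σ _ _)   ()
  same-former (∼N _)     (∼I _ _ _) ()
  same-former (∼N _)     (∼W _ _ _) ()
  same-former ∼Nω        (∼N _)     ()
  same-former ∼Nω        (∼Π _ _)   ()
  same-former ∼Nω        (∼Σ _ _)   ()
  same-former ∼Nω        (∼I _ _ _) ()
  same-former ∼Nω        (∼W _ _ _) ()
  same-former (∼Π _ _)   (∼N _)     ()
  same-former (∼Π _ _)   ∼Nω        ()
  same-former (∼Π _ _)   (∼Σ _ _)   ()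
  same-former (∼Π _ _)   (∼I _ _ _) ()
  same-former (∼Π _ _)   (∼W _ _ _) ()
  same-former (∼Σ _ _)   (∼N _)     ()
  same-former (∼Σ _ _)   ∼Nω        ()
  same-former (∼Σ _ _)   (∼Π _ _)   ()
  same-former (∼Σ _ _)   (∼I _ _ _) ()
  same-former (∼Σ _ _)   (∼W _ _ _) ()
  same-former (∼I _ _ _) (∼N _)     ()
  same-former (∼I _ _ _) ∼Nω        ()
  same-former (∼I _ _ _) (∼Π _ _)   ()
  same-former (∼I _ _ _) (∼Σ _ _)   ()
  same-former (∼I _ _ _) (∼W _ _ _) ()
  same-former (∼W _ _ _) (∼N _)     ()
  same-former (∼W _ _ _) ∼Nω        ()
  same-former (∼W _ _ _) (∼Π _ _)   ()
  same-former (∼W _ _ _) (∼Σ _ _)   ()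
  same-former (∼W _ _ _) (∼I _ _ _) ()

  ShareEnd⇒SameFormer : (D : σ ∼ τ) (D′ : σ′ ∼ τ′) →
                         ShareEnd σ τ σ′ τ′ → SameFormer D D′
  ShareEnd⇒SameFormer D D′ (s , s′ , e) = same-former D D′ (num-injective
    (App-functional (p₀-code D s) (subst (λ z → App p₀ z _) (sym e) (p₀-code D′ s′))))

  ShareEnd-N : ∀ {n n′} → ShareEnd (N-code n) (N-code n) (N-code n′) (N-code n′) → n ≡ n′
  ShareEnd-N {n} {n′} (s , s′ , e) = num-injective (proj₂ (pair-injective
    (trans (sym (pick-diag s (N-code n))) (trans e (pick-diag s′ (N-code n′))))))

  pick-tagged-injective : ∀ {s s′ k x y x′ y′ u v u′ v′} →
    pick s (pair k (pair x x′)) (pair k (pair y y′)) ≡ pick s′ (pair k (pair u u′)) (pair k (pair v v′)) →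
    pick s x y ≡ pick s′ u v × pick s x′ y′ ≡ pick s′ u′ v′
  pick-tagged-injective {s} {s′} {k} e = pair-injective (proj₂ (pair-injective
    (trans (sym (pick-natural s tagged)) (trans e (pick-natural s′ tagged)))))
    where
      tagged : A → A → A
      tagged x y = pair k (pair x y)

  ShareEnd-binder : ∀ {k} →
    ShareEnd (pair k (pair σ i)) (pair k (pair τ j)) (pair k (pair σ′ i′)) (pair k (pair τ′ j′)) →
    ShareEnd σ τ σ′ τ′ × ShareEnd i j i′ j′
  ShareEnd-binder (s , s′ , e) = let (eσ , ei) = pick-tagged-injective e in (s , s′ , eσ) , (s , s′ , ei)

  ShareEnd-I : ∀ {k a a′ b b′ c c′ d d′} →
    ShareEnd (pair k (pair σ (pair a b))) (pair k (pair τ (pair a′ b′)))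
             (pair k (pair σ′ (pair c d))) (pair k (pair τ′ (pair c′ d′))) →
    ShareEnd σ τ σ′ τ′ × Σ Bool λ s → Σ Bool λ s′ → pick s a a′ ≡ pick s′ c c′ × pick s b b′ ≡ pick s′ d d′
  ShareEnd-I (s , s′ , e) = let (eσ , eab) = pick-tagged-injective e in
    (s , s′ , eσ) , s , s′ ,
    pair-injective (trans (sym (pick-natural s pair)) (trans eab (pick-natural s′ pair)))

  ShareArg : A → A → A → A → A → A → A → A → Set
  ShareArg i j a b i′ j′ a′ b′ =
    Σ Bool λ s → Σ Bool λ s′ → pick s i j ≡ pick s′ i′ j′ × pick s a b ≡ pick s′ a′ b′

  ShareArg⇒ShareEnd : ∀ {i j a b ia jb i′ j′ a′ b′ ia′ jb′} →
    App i a ia → App j b jb → App i′ a′ ia′ → App j′ b′ jb′ →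
    ShareArg i j a b i′ j′ a′ b′ → ShareEnd ia jb ia′ jb′
  ShareArg⇒ShareEnd ia jb ia′ jb′ (s , s′ , ei , ea) =
    s , s′ , App-functional (pick-App s ia jb)
      (subst₂ (λ u v → App u v _) (sym ei) (sym ea) (pick-App s′ ia′ jb′))

  Applied : ∀ {a b} → Fam i j a b → A → A → Set
  Applied {a = a} {b = b} φ f g = Σ A λ fa → Σ A λ gb → App f a fa × App g b gb × ElF φ fa gb

  ElΠ-out : ∀ {a b f g} (φ : Fam i j a b) → ElΠ φ f g → Applied φ f g
  ElΠ-out (fam _ _ _ _ _) h = h

  ElΠ-in : ∀ {a b f g} (φ : Fam i j a b) → Applied φ f g → ElΠ φ f g
  ElΠ-in (fam _ _ _ _ _) h = h

  WRel : (E : σ ∼ τ) → FamOf E i j → A → A → Set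
  WRel E F = WR (El E) (λ c₀ e₀ h → ElF (F c₀ e₀ h))

  WStep : (E : σ ∼ τ) (F : FamOf E i j) → A → A → A → A → Set
  WStep E F c₁ e₁ q r = Σ A λ cq → Σ A λ er →
    App c₁ q cq × App e₁ r er × WRel E F cq er

  mutual
    El-to : (D : σ ∼ τ) (D′ : σ′ ∼ τ′) → ShareEnd σ τ σ′ τ′ →
            ∀ {a b} → El D a b → El D′ a b
    El-to D D′ sh = El-to-same D D′ (ShareEnd⇒SameFormer D D′ sh) sh

    El-from : (D : σ ∼ τ) (D′ : σ′ ∼ τ′) → ShareEnd σ τ σ′ τ′ →
              ∀ {a b} → El D′ a b → El D a b
    El-from D D′ sh = El-to D′ D (ShareEnd-sym sh)

    El-to-same : (D : σ ∼ τ) (D′ : σ′ ∼ τ′) → SameFormer D D′ → ShareEnd σ τ σ′ τ′ →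
                 ∀ {a b} → El D a b → El D′ a b
    El-to-same (∼N _) (∼N _) N-N sh (m , m<n , ea , eb) = m , subst (m <_) (ShareEnd-N sh) m<n , ea , eb
    El-to-same ∼Nω ∼Nω Nω-Nω _ h = h
    El-to-same (∼Π E F) (∼Π E′ F′) Π-Π sh hf a b h′ with ShareEnd-binder sh
    ... | shσ , shi =
      let h = El-from E E′ shσ h′
          (fa , gb , app-f , app-g , t) = ElΠ-out (F a b h) (hf a b h)
      in ElΠ-in (F′ a b h′) (fa , gb , app-f , app-g , ElF-cross E F E′ F′ shi h h′ t)
    El-to-same (∼Σ E F) (∼Σ E′ F′) Σ-Σ sh (c₀ , c₁ , e₀ , e₁ , π₀c , π₁c , π₀e , π₁e , h , t)
      with ShareEnd-binder sh
    ... | shσ , shi =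
      let h′ = El-to E E′ shσ h
      in c₀ , c₁ , e₀ , e₁ , π₀c , π₁c , π₀e , π₁e , h′ , ElF-cross E F E′ F′ shi h h′ t
    El-to-same (∼I E x y) (∼I E′ x′ y′) I-I sh (c≡𝟎 , e≡𝟎 , hab) with ShareEnd-I sh
    ... | shσ , s , s′ , ea , eb =
      c≡𝟎 , e≡𝟎 , El-to E E′ shσ
        (El-endpoints E s s′ x y (El-from E E′ shσ x′) (El-from E E′ shσ y′) ea eb hab)
    El-to-same (∼W _ E F) (∼W _ E′ F′) W-W sh r with ShareEnd-binder sh
    ... | shσ , shi = W-to E F E′ F′ shσ shi r

    El-endpoints : ∀ (E : σ ∼ τ) s s′ {a a′ b b′ c c′ d d′} →
                   El E a a′ → El E b b′ → El E c c′ → El E d d′ →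
                   pick s a a′ ≡ pick s′ c c′ → pick s b b′ ≡ pick s′ d d′ → El E a b → El E c d
    El-endpoints E s s′ {a} {a′} {b} {b′} {c} {d = d} haa′ hbb′ hcc′ hdd′ ea eb hab =
      El-trans E hc (El-trans E (El-sym E (El-pick E s haa′))
        (El-trans E hab (El-trans E (El-pick E s hbb′) (El-sym E hd))))
      where
        hc : El E c (pick s a a′)
        hc = subst (El E c) (sym ea) (El-pick E s′ hcc′)
        hd : El E d (pick s b b′)
        hd = subst (El E d) (sym eb) (El-pick E s′ hdd′)

    El-sym : ∀ (D : σ ∼ τ) {a b} → El D a b → El D b a
    El-sym (∼N _) (m , m<n , ea , eb) = m , m<n , eb , ea
    El-sym ∼Nω (m , ea , eb) = m , eb , ea
    El-sym (∼Π E F) hf a b h =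
      let hba = El-sym E h
          (fb , ga , app-f , app-g , t) = ElΠ-out (F b a hba) (hf b a hba)
          haa = El-reflʳ E hba
      in ElΠ-in (F a b h) (ga , fb , app-g , app-f ,
           ElF-reindex E F false haa h refl (ElF-reindex E F true hba haa refl (ElF-sym (F b a hba) t)))
    El-sym (∼Σ E F) (c₀ , c₁ , e₀ , e₁ , π₀c , π₁c , π₀e , π₁e , h , t) =
      let hee = El-reflʳ E h
      in e₀ , e₁ , c₀ , c₁ , π₀e , π₁e , π₀c , π₁c , El-sym E h ,
         ElF-reindex E F false hee (El-sym E h) refl
           (ElF-reindex E F true h hee refl (ElF-sym (F c₀ e₀ h) t))
    El-sym (∼I _ _ _) (c≡𝟎 , e≡𝟎 , hab) = e≡𝟎 , c≡𝟎 , hab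
    El-sym (∼W _ E F) r = W-sym E F r

    El-trans : ∀ (D : σ ∼ τ) {a b c} → El D a b → El D b c → El D a c
    El-trans (∼N _) (m , m<n , ea , eb) (_ , _ , eb′ , ec) =
      m , m<n , ea , trans ec (cong num (sym (num-injective (trans (sym eb) eb′))))
    El-trans ∼Nω (m , ea , eb) (_ , eb′ , ec) =
      m , ea , trans ec (cong num (sym (num-injective (trans (sym eb) eb′))))
    El-trans (∼Π E F) hf hg a b h =
      El-trans-Applied E F h (ElΠ-out (F a b h) (hf a b h))
                             (ElΠ-out (F b b (El-reflʳ E h)) (hg b b (El-reflʳ E h)))
    El-trans (∼Σ E F) (c₀ , c₁ , e₀ , e₁ , π₀c , π₁c , π₀e , π₁e , h , t)
                      (_ , _ , k₀ , k₁ , π₀e′ , π₁e′ , π₀k , π₁k , h′ , t′)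
      with App-functional π₀e π₀e′ | App-functional π₁e π₁e′
    ... | refl | refl =
      let hck = El-trans E h h′
      in c₀ , c₁ , k₀ , k₁ , π₀c , π₁c , π₀k , π₁k , hck ,
         ElF-trans (F c₀ k₀ hck) (ElF-reindex E F false h hck refl t) (ElF-reindex E F true h′ hck refl t′)
    El-trans (∼I _ _ _) (c≡𝟎 , _ , hab) (_ , k≡𝟎 , _) = c≡𝟎 , k≡𝟎 , hab
    El-trans (∼W _ E F) r r′ = W-trans E F r r′

    El-reflˡ : ∀ (D : σ ∼ τ) {a b} → El D a b → El D a a
    El-reflˡ D h = El-trans D h (El-sym D h)

    El-reflʳ : ∀ (D : σ ∼ τ) {a b} → El D a b → El D b b
    El-reflʳ D h = El-trans D (El-sym D h) h

    El-pick : ∀ (D : σ ∼ τ) s {a b} → El D a b → El D a (pick s a b)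
    El-pick D false h = El-reflˡ D h
    El-pick D true  h = h

    El-pick-refl : ∀ (D : σ ∼ τ) s {a b} → El D a b → El D (pick s a b) (pick s a b)
    El-pick-refl D false h = El-reflˡ D h
    El-pick-refl D true  h = El-reflʳ D h

    El-trans-Applied : ∀ (E : σ ∼ τ) (F : FamOf E i j) {a b f g k} (h : El E a b) →
                       Applied (F a b h) f g → Applied (F b b (El-reflʳ E h)) g k → ElΠ (F a b h) f k
    El-trans-Applied E F h (fa , gb , app-f , app-g , t) (gb′ , kb , app-g′ , app-k , t′)
      with App-functional app-g app-g′
    ... | refl = ElΠ-in (F _ _ h)
      (fa , kb , app-f , app-k , ElF-trans (F _ _ h) t (ElF-reindex E F true (El-reflʳ E h) h refl t′))

    ElF-to : ∀ {a b a′ b′} (φ : Fam i j a b) (ψ : Fam i′ j′ a′ b′) →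
             ShareArg i j a b i′ j′ a′ b′ → ∀ {x y} → ElF φ x y → ElF ψ x y
    ElF-to (fam _ _ ia jb T) (fam _ _ ia′ jb′ T′) sh = El-to T T′ (ShareArg⇒ShareEnd ia jb ia′ jb′ sh)

    ElF-sym : ∀ {a b} (φ : Fam i j a b) {x y} → ElF φ x y → ElF φ y x
    ElF-sym (fam _ _ _ _ T) = El-sym T

    ElF-trans : ∀ {a b} (φ : Fam i j a b) {x y z} → ElF φ x y → ElF φ y z → ElF φ x z
    ElF-trans (fam _ _ _ _ T) = El-trans T

    ElF-reflˡ : ∀ {a b} (φ : Fam i j a b) {x y} → ElF φ x y → ElF φ x x
    ElF-reflˡ φ t = ElF-trans φ t (ElF-sym φ t)

    ElF-reflʳ : ∀ {a b} (φ : Fam i j a b) {x y} → ElF φ x y → ElF φ y y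
    ElF-reflʳ φ t = ElF-trans φ (ElF-sym φ t) t

    ElF-reindex : ∀ (E : σ ∼ τ) (F : FamOf E i j) s {a b a′ b′} (h : El E a b) (h′ : El E a′ b′) →
                  pick s a b ≡ pick s a′ b′ → ∀ {x y} → ElF (F a b h) x y → ElF (F a′ b′ h′) x y
    ElF-reindex E F s h h′ e = ElF-to (F _ _ h) (F _ _ h′) (s , s , refl , e)

    -- Goes through F at the diagonal argument pick s′ a b,
    -- as ShareArg takes function and argument from the same side.
    ElF-cross : (E : σ ∼ τ) (F : FamOf E i j) (E′ : σ′ ∼ τ′) (F′ : FamOf E′ i′ j′) →
                ShareEnd i j i′ j′ → ∀ {a b} (h : El E a b) (h′ : El E′ a b) →
                ∀ {x y} → ElF (F a b h) x y → ElF (F′ a b h′) x y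
    ElF-cross E F E′ F′ (s , s′ , ei) {a} {b} h h′ t =
      ElF-to (F _ _ (El-pick-refl E s′ h)) (F′ a b h′) (s , s′ , ei , pick-diag s (pick s′ a b))
        (ElF-to (F a b h) (F _ _ (El-pick-refl E s′ h))
                (s′ , s′ , refl , sym (pick-diag s′ (pick s′ a b))) t)

    W-to : (E : σ ∼ τ) (F : FamOf E i j) (E′ : σ′ ∼ τ′) (F′ : FamOf E′ i′ j′) →
           ShareEnd σ τ σ′ τ′ → ShareEnd i j i′ j′ → ∀ {c e} → WRel E F c e → WRel E′ F′ c e
    W-to E F E′ F′ shσ shi (wsup c₀ c₁ e₀ e₁ π₀c π₁c π₀e π₁e h k) =
      let h′ = El-to E E′ shσ h
      in wsup c₀ c₁ e₀ e₁ π₀c π₁c π₀e π₁e h′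
           (λ q r t → WStep-to E F E′ F′ shσ shi (k q r (ElF-cross E′ F′ E F (ShareEnd-sym shi) h′ h t)))

    WStep-to : (E : σ ∼ τ) (F : FamOf E i j) (E′ : σ′ ∼ τ′) (F′ : FamOf E′ i′ j′) →
               ShareEnd σ τ σ′ τ′ → ShareEnd i j i′ j′ → ∀ {c₁ e₁ q r} →
               WStep E F c₁ e₁ q r → WStep E′ F′ c₁ e₁ q r
    WStep-to E F E′ F′ shσ shi (cq , er , app-c , app-e , w) =
      cq , er , app-c , app-e , W-to E F E′ F′ shσ shi w

    W-sym : (E : σ ∼ τ) (F : FamOf E i j) → ∀ {c e} → WRel E F c e → WRel E F e c
    W-sym E F (wsup c₀ c₁ e₀ e₁ π₀c π₁c π₀e π₁e h k) =
      wsup e₀ e₁ c₀ c₁ π₀e π₁e π₀c π₁c (El-sym E h) λ q r t →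
        WStep-sym E F (k r q (ElF-reindex E F true (El-reflʳ E h) h refl
          (ElF-reindex E F false (El-sym E h) (El-reflʳ E h) refl (ElF-sym (F e₀ c₀ (El-sym E h)) t))))

    WStep-sym : (E : σ ∼ τ) (F : FamOf E i j) → ∀ {c₁ e₁ q r} →
                WStep E F c₁ e₁ r q → WStep E F e₁ c₁ q r
    WStep-sym E F (cr , eq , app-c , app-e , w) = eq , cr , app-e , app-c , W-sym E F w

    W-trans : (E : σ ∼ τ) (F : FamOf E i j) → ∀ {c e k} → WRel E F c e → WRel E F e k → WRel E F c k
    W-trans E F (wsup c₀ c₁ e₀ e₁ π₀c π₁c π₀e π₁e h k) (wsup _ _ k₀ k₁ π₀e′ π₁e′ π₀k π₁k h′ k′)
      with App-functional π₀e π₀e′ | App-functional π₁e π₁e′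
    ... | refl | refl =
      let hck = El-trans E h h′
      in wsup c₀ c₁ k₀ k₁ π₀c π₁c π₀k π₁k hck λ q r t →
           WStep-trans E F (k q r (ElF-reindex E F false hck h refl t))
             (k′ r r (ElF-reindex E F true hck h′ refl (ElF-reflʳ (F c₀ k₀ hck) t)))

    WStep-trans : (E : σ ∼ τ) (F : FamOf E i j) → ∀ {c₁ e₁ k₁ q r} →
                  WStep E F c₁ e₁ q r → WStep E F e₁ k₁ r r → WStep E F c₁ k₁ q r
    WStep-trans E F (cq , er , app-c , app-e , w) (er′ , kr , app-e′ , app-k , w′)
      with App-functional app-e app-e′
    ... | refl = cq , kr , app-c , app-k , W-trans E F w w′

  Idx : V → Set
  Idx (sup I _) = I

  elt : (x : V) → Idx x → A × A × V
  elt (sup _ f) i = f i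

  -- Equality of V forgetting the realizer labels: what a realizer of x = y guarantees.
  mutual
    infix 4 _≅_ _≅₃_
    _≅_ : V → V → Set
    sup I f ≅ sup J g = (∀ i → Σ J λ j → f i ≅₃ g j) × (∀ j → Σ I λ i → f i ≅₃ g j)

    _≅₃_ : A × A × V → A × A × V → Set
    (_ , _ , x) ≅₃ (_ , _ , y) = x ≅ y

  ≅-forth : ∀ {x y} → x ≅ y → ∀ i → Σ (Idx y) λ j → elt x i ≅₃ elt y j
  ≅-forth {sup _ _} {sup _ _} = proj₁

  mutual
    ≅-sym : ∀ {x y} → x ≅ y → y ≅ x
    ≅-sym {sup _ f} {sup _ g} (forth , back) =
      (λ j → let (i , e) = back j in i , ≅₃-sym (f i) (g j) e) ,
      (λ i → let (j , e) = forth i in j , ≅₃-sym (f i) (g j) e)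

    ≅₃-sym : ∀ t t′ → t ≅₃ t′ → t′ ≅₃ t
    ≅₃-sym (_ , _ , _) (_ , _ , _) = ≅-sym

  mutual
    ≅-trans : ∀ {x y z} → x ≅ y → y ≅ z → x ≅ z
    ≅-trans {sup _ f} {sup _ g} {sup _ h} (forth , back) (forth′ , back′) =
      (λ i → let (j , e) = forth i ; (k , e′) = forth′ j in k , ≅₃-trans (f i) (g j) (h k) e e′) ,
      (λ k → let (j , e′) = back′ k ; (i , e) = back j in i , ≅₃-trans (f i) (g j) (h k) e e′)

    ≅₃-trans : ∀ t t′ t″ → t ≅₃ t′ → t′ ≅₃ t″ → t ≅₃ t″
    ≅₃-trans (_ , _ , _) (_ , _ , _) (_ , _ , _) = ≅-trans

  mutual
    ≈⇒≅ : ∀ {x y} → x ≈ y → x ≅ y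
    ≈⇒≅ {sup _ f} {sup _ g} (forth , back) =
      (λ i → let (j , e) = forth i in j , ≈₃⇒≅₃ (f i) (g j) e) ,
      (λ j → let (i , e) = back j in i , ≈₃⇒≅₃ (f i) (g j) e)

    ≈₃⇒≅₃ : ∀ t t′ → t ≈₃ t′ → t ≅₃ t′
    ≈₃⇒≅₃ (_ , _ , _) (_ , _ , _) (_ , _ , e) = ≈⇒≅ e

  mutual
    ≈-refl : ∀ x → x ≈ x
    ≈-refl (sup _ f) = (λ i → i , ≈₃-refl (f i)) , (λ i → i , ≈₃-refl (f i))

    ≈₃-refl : ∀ t → t ≈₃ t
    ≈₃-refl (_ , _ , x) = refl , refl , ≈-refl x

  mutual
    ≈-sym : ∀ {x y} → x ≈ y → y ≈ x
    ≈-sym {sup _ f} {sup _ g} (forth , back) =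
      (λ j → let (i , e) = back j in i , ≈₃-sym (f i) (g j) e) ,
      (λ i → let (j , e) = forth i in j , ≈₃-sym (f i) (g j) e)

    ≈₃-sym : ∀ t t′ → t ≈₃ t′ → t′ ≈₃ t
    ≈₃-sym (_ , _ , _) (_ , _ , _) (ea , eb , e) = sym ea , sym eb , ≈-sym e

  mutual
    ≈-trans : ∀ {x y z} → x ≈ y → y ≈ z → x ≈ z
    ≈-trans {sup _ f} {sup _ g} {sup _ h} (forth , back) (forth′ , back′) =
      (λ i → let (j , e) = forth i ; (k , e′) = forth′ j in k , ≈₃-trans (f i) (g j) (h k) e e′) ,
      (λ k → let (j , e′) = back′ k ; (i , e) = back j in i , ≈₃-trans (f i) (g j) (h k) e e′)

    ≈₃-trans : ∀ t t′ t″ → t ≈₃ t′ → t′ ≈₃ t″ → t ≈₃ t″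
    ≈₃-trans (_ , _ , _) (_ , _ , _) (_ , _ , _) (ea , eb , e) (ea′ , eb′ , e′) =
      trans ea ea′ , trans eb eb′ , ≈-trans e e′

  ≈-pointwise : ∀ {I} {f g : I → A × A × V} → (∀ i → f i ≈₃ g i) → sup I f ≈ sup I g
  ≈-pointwise same = (λ i → i , same i) , (λ i → i , same i)

  ≈-sup-⇔ : ∀ {P Q : A → A → Set}
              {f : (Σ A λ q → Σ A (P q)) → A × A × V} {g : (Σ A λ q → Σ A (Q q)) → A × A × V} →
            (∀ {q r} → P q r → Q q r) → (∀ {q r} → Q q r → P q r) →
            (∀ q r (t : P q r) (t′ : Q q r) → f (q , r , t) ≈₃ g (q , r , t′)) →
            sup _ f ≈ sup _ g
  ≈-sup-⇔ to from same =
    (λ { (q , r , t) → (q , r , to t) , same q r t (to t) }) ,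
    (λ { (q , r , t′) → (q , r , from t′) , same q r (from t′) t′ })

  mutual
    Realize-eq⇒≅ : ∀ {a b} x y → Realize-eq a b x y → x ≅ y
    Realize-eq⇒≅ (sup _ f) (sup J g) (forth , back) =
      (λ i → Realize-mem⇒elt (f i) J g (forth i)) ,
      (λ j → let (i , e) = Realize-mem⇒elt (g j) _ f (back j) in i , ≅₃-sym (g j) (f i) e)

    Realize-mem⇒elt : ∀ {π a b} (t : A × A × V) (J : Set) (g : J → A × A × V) →
                      EqStep π a b t (sup J g) → Σ J λ j → t ≅₃ g j
    Realize-mem⇒elt (_ , _ , z) J g
      (_ , _ , _ , _ , _ , _ , _ , _ , _ , _ , _ , _ , _ , _ , _ , _ , j , mem) =
      j , MemStep⇒≅ z (g j) mem

    MemStep⇒≅ : ∀ {a₀ b₀ a₁ b₁} z t → MemStep a₀ b₀ a₁ b₁ z t → (𝟎 , 𝟎 , z) ≅₃ t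
    MemStep⇒≅ z (_ , _ , z′) (_ , _ , r) = Realize-eq⇒≅ z z′ r

  -- y meets x′ or y′; if it meets only x′, then y′ meets x, and all four agree.
  ⟨,⟩-injective : ∀ {x y x′ y′} → ⟨ x , y ⟩A ≅ ⟨ x′ , y′ ⟩A → x ≅ x′ × y ≅ y′
  ⟨,⟩-injective {x} {y} {x′} {y′} (forth , back) = x≅x′ , y≅y′
    where
      x≅x′ : x ≅ x′
      x≅x′ with forth false
      ... | false , e = proj₂ (proj₁ e tt)
      ... | true  , e = proj₂ (proj₂ e false)
      y≅x′⊎y≅y′ : y ≅ x′ ⊎ y ≅ y′
      y≅x′⊎y≅y′ with forth true
      ... | false , e = inj₁ (proj₂ (proj₁ e true))
      ... | true  , e with proj₁ e true
      ...   | false , e′ = inj₁ e′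
      ...   | true  , e′ = inj₂ e′
      x≅y′⊎y≅y′ : x ≅ y′ ⊎ y ≅ y′
      x≅y′⊎y≅y′ with back true
      ... | false , e = inj₁ (proj₂ (proj₂ e true))
      ... | true  , e with proj₂ e true
      ...   | false , e′ = inj₁ e′
      ...   | true  , e′ = inj₂ e′
      y≅y′ : y ≅ y′
      y≅y′ with y≅x′⊎y≅y′ | x≅y′⊎y≅y′
      ... | inj₂ e | _      = e
      ... | inj₁ _ | inj₂ e = e
      ... | inj₁ e | inj₁ e′ = ≅-trans e (≅-trans (≅-sym x≅x′) e′)

  ⟨,⟩-cong : ∀ {x y x′ y′} → x ≈ x′ → y ≈ y′ → ⟨ x , y ⟩A ≈ ⟨ x′ , y′ ⟩A
  ⟨,⟩-cong ex ey = ≈-pointwise λ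
    { false → refl , refl , ≈-pointwise (λ _ → refl , refl , ex)
    ; true  → refl , refl , ≈-pointwise λ { false → refl , refl , ex ; true → refl , refl , ey } }

  dot-elements : ∀ n (i : Idx (dot n)) → Σ ℕ λ k → k < n × elt (dot n) i ≡ (num k , num k , dot k)
  dot-elements (suc n) i with dot n in eq | dot-elements n
  dot-elements (suc n) (just j) | sup _ _ | older with older j
  ... | k , k<n , e = k , m<n⇒m<1+n k<n , e
  dot-elements (suc n) nothing  | sup _ _ | _ = n , ≤-refl , cong (λ z → num n , num n , z) (sym eq)

  dot-newest : ∀ n → Σ (Idx (dot (suc n))) λ i → elt (dot (suc n)) i ≡ (num n , num n , dot n)
  dot-newest n with dot n
  ... | sup _ _ = nothing , refl

  dot-≅⇒≤ : ∀ m n → dot m ≅ dot n → m ≤ n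
  dot-≅⇒≤ zero    n _ = z≤n
  dot-≅⇒≤ (suc m) n e =
    let (i , ei) = dot-newest m
        (j , r) = ≅-forth e i
        (k , k<n , ej) = dot-elements n j
    in ≤-<-trans (dot-≅⇒≤ m k (subst₂ _≅₃_ ei ej r)) k<n

  dot-injective : ∀ {m n} → dot m ≅ dot n → m ≡ n
  dot-injective {m} {n} e = ≤-antisym (dot-≅⇒≤ m n e) (dot-≅⇒≤ n m (≅-sym e))

  ⟦Applied⟧ : ∀ {a b f g} (φ : Fam i j a b) → Applied φ f g → V
  ⟦Applied⟧ φ (fa , gb , _ , _ , t) = ⟦F⟧ φ fa gb t

  ⟦Π⟧≈⟦Applied⟧ : ∀ {a b f g} (φ : Fam i j a b) (p : ElΠ φ f g) → ⟦Π⟧ φ f g p ≈ ⟦Applied⟧ φ (ElΠ-out φ p)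
  ⟦Π⟧≈⟦Applied⟧ (fam _ _ _ _ _) _ = ≈-refl _

  mutual
    ⟦⟧-shared : (D : σ ∼ τ) (D′ : σ′ ∼ τ′) → ShareEnd σ τ σ′ τ′ →
                ∀ {a a′ a″} (h : El D a a′) (h′ : El D′ a a″) → ⟦ D ⟧ a a′ h ≈ ⟦ D′ ⟧ a a″ h′
    ⟦⟧-shared D D′ sh = ⟦⟧-shared-same D D′ (ShareEnd⇒SameFormer D D′ sh) sh

    ⟦⟧-shared-same : (D : σ ∼ τ) (D′ : σ′ ∼ τ′) → SameFormer D D′ → ShareEnd σ τ σ′ τ′ →
                     ∀ {a a′ a″} (h : El D a a′) (h′ : El D′ a a″) → ⟦ D ⟧ a a′ h ≈ ⟦ D′ ⟧ a a″ h′
    ⟦⟧-shared-same (∼N _) (∼N _) N-N _ (_ , _ , ea , _) (_ , _ , ea′ , _)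
      with num-injective (trans (sym ea) ea′)
    ... | refl = ≈-refl _
    ⟦⟧-shared-same ∼Nω ∼Nω Nω-Nω _ (_ , ea , _) (_ , ea′ , _)
      with num-injective (trans (sym ea) ea′)
    ... | refl = ≈-refl _
    ⟦⟧-shared-same (∼Π E F) (∼Π E′ F′) Π-Π sh {f} {f′} {g′} hf hg with ShareEnd-binder sh
    ... | shσ , shi = ≈-sup-⇔ (El-to E E′ shσ) (El-from E E′ shσ)
                               λ x y h h′ → refl , refl , component x y h h′
      where
        component : ∀ x y (h : El E x y) (h′ : El E′ x y) →
                    ⟨ ⟦ E ⟧ x y h , ⟦Π⟧ (F x y h) f f′ (hf x y h) ⟩A ≈
                    ⟨ ⟦ E′ ⟧ x y h′ , ⟦Π⟧ (F′ x y h′) f g′ (hg x y h′) ⟩A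
        component x y h h′ = ⟨,⟩-cong (⟦⟧-shared E E′ shσ h h′)
          (≈-trans (⟦Π⟧≈⟦Applied⟧ (F x y h) (hf x y h))
            (≈-trans (⟦Applied⟧-cross E F E′ F′ shi h h′ (ElΠ-out (F x y h) (hf x y h))
                                                             (ElΠ-out (F′ x y h′) (hg x y h′)))
              (≈-sym (⟦Π⟧≈⟦Applied⟧ (F′ x y h′) (hg x y h′)))))
    ⟦⟧-shared-same (∼Σ E F) (∼Σ E′ F′) Σ-Σ sh
      (c₀ , _ , e₀ , _ , π₀c , π₁c , _ , _ , h , t) (_ , _ , e₀′ , _ , π₀c′ , π₁c′ , _ , _ , h′ , t′)
      with App-functional π₀c π₀c′ | App-functional π₁c π₁c′ | ShareEnd-binder sh
    ... | refl | refl | shσ , shi =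
      let h″ = El-from E E′ shσ h′
          t″ = ElF-reindex E F false h h″ refl (ElF-reflˡ (F c₀ e₀ h) t)
      in ⟨,⟩-cong (⟦⟧-shared E E′ shσ h h′)
           (≈-trans (⟦F⟧-reindex E F false h h″ refl t t″)
                    (⟦F⟧-cross E F E′ F′ shi h″ h′ t″ t′))
    ⟦⟧-shared-same (∼I _ _ _) (∼I _ _ _) I-I _ _ _ = ≈-refl _
    ⟦⟧-shared-same (∼W _ E F) (∼W _ E′ F′) W-W sh h h′ with ShareEnd-binder sh
    ... | shσ , shi = ⟦W⟧-shared E F E′ F′ shσ shi h h′

    ⟦F⟧-shared : ∀ {a b a′ b′} (φ : Fam i j a b) (ψ : Fam i′ j′ a′ b′) → ShareArg i j a b i′ j′ a′ b′ →
                 ∀ {x x′ x″} (t : ElF φ x x′) (t′ : ElF ψ x x″) → ⟦F⟧ φ x x′ t ≈ ⟦F⟧ ψ x x″ t′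
    ⟦F⟧-shared (fam _ _ ia jb T) (fam _ _ ia′ jb′ T′) sh =
      ⟦⟧-shared T T′ (ShareArg⇒ShareEnd ia jb ia′ jb′ sh)

    ⟦F⟧-reindex : ∀ (E : σ ∼ τ) (F : FamOf E i j) s {a b a′ b′} (h : El E a b) (h′ : El E a′ b′) →
                  pick s a b ≡ pick s a′ b′ →
                  ∀ {x x′ x″} (t : ElF (F a b h) x x′) (t′ : ElF (F a′ b′ h′) x x″) →
                  ⟦F⟧ (F a b h) x x′ t ≈ ⟦F⟧ (F a′ b′ h′) x x″ t′
    ⟦F⟧-reindex E F s h h′ e = ⟦F⟧-shared (F _ _ h) (F _ _ h′) (s , s , refl , e)

    ⟦F⟧-cross : (E : σ ∼ τ) (F : FamOf E i j) (E′ : σ′ ∼ τ′) (F′ : FamOf E′ i′ j′) →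
                ShareEnd i j i′ j′ → ∀ {a b} (h : El E a b) (h′ : El E′ a b) →
                ∀ {x x′ x″} (t : ElF (F a b h) x x′) (t′ : ElF (F′ a b h′) x x″) →
                ⟦F⟧ (F a b h) x x′ t ≈ ⟦F⟧ (F′ a b h′) x x″ t′
    ⟦F⟧-cross E F E′ F′ (s , s′ , ei) {a} {b} h h′ t t′ =
      ≈-trans (⟦F⟧-shared (F a b h) (F _ _ (El-pick-refl E s′ h)) to-diagonal t t₀)
              (⟦F⟧-shared (F _ _ (El-pick-refl E s′ h)) (F′ a b h′)
                          (s , s′ , ei , pick-diag s (pick s′ a b)) t₀ t′)
      where
        to-diagonal : ShareArg _ _ a b _ _ (pick s′ a b) (pick s′ a b)
        to-diagonal = s′ , s′ , refl , sym (pick-diag s′ (pick s′ a b))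
        t₀ : ElF (F _ _ (El-pick-refl E s′ h)) _ _
        t₀ = ElF-to (F a b h) (F _ _ (El-pick-refl E s′ h)) to-diagonal (ElF-reflˡ (F a b h) t)

    ⟦Applied⟧-cross : (E : σ ∼ τ) (F : FamOf E i j) (E′ : σ′ ∼ τ′) (F′ : FamOf E′ i′ j′) →
                      ShareEnd i j i′ j′ → ∀ {a b f f′ g′} (h : El E a b) (h′ : El E′ a b) →
                      (u : Applied (F a b h) f f′) (v : Applied (F′ a b h′) f g′) →
                      ⟦Applied⟧ (F a b h) u ≈ ⟦Applied⟧ (F′ a b h′) v
    ⟦Applied⟧-cross E F E′ F′ shi h h′ (_ , _ , app-f , _ , t) (_ , _ , app-f′ , _ , t′)
      with App-functional app-f app-f′
    ... | refl = ⟦F⟧-cross E F E′ F′ shi h h′ t t′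

    ⟦W⟧-shared : (E : σ ∼ τ) (F : FamOf E i j) (E′ : σ′ ∼ τ′) (F′ : FamOf E′ i′ j′) →
                 ShareEnd σ τ σ′ τ′ → ShareEnd i j i′ j′ → ∀ {c e e′} →
                 (w : WRel E F c e) (w′ : WRel E′ F′ c e′) →
                 ⟦W⟧ E F w ≈ ⟦W⟧ E′ F′ w′
    ⟦W⟧-shared E F E′ F′ shσ shi (wsup c₀ _ e₀ _ π₀c π₁c _ _ h k) (wsup _ _ e₀′ _ π₀c′ π₁c′ _ _ h′ k′)
      with App-functional π₀c π₀c′ | App-functional π₁c π₁c′
    ... | refl | refl =
      ⟨,⟩-cong (⟦⟧-shared E E′ shσ h h′) (≈-sup-⇔ forth back λ q r t t′ → refl , refl , component q r t t′)
      where
        h″ : El E c₀ e₀′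
        h″ = El-from E E′ shσ h′
        forth : ∀ {q r} → ElF (F c₀ e₀ h) q r → ElF (F′ c₀ e₀′ h′) q r
        forth t = ElF-cross E F E′ F′ shi h″ h′ (ElF-reindex E F false h h″ refl t)
        back : ∀ {q r} → ElF (F′ c₀ e₀′ h′) q r → ElF (F c₀ e₀ h) q r
        back t′ = ElF-reindex E F false h″ h refl (ElF-cross E′ F′ E F (ShareEnd-sym shi) h′ h″ t′)
        component : ∀ q r (t : ElF (F c₀ e₀ h) q r) (t′ : ElF (F′ c₀ e₀′ h′) q r) →
                    ⟨ ⟦F⟧ (F c₀ e₀ h) q r t , ⟦W⟧step E F (k q r t) ⟩A ≈
                    ⟨ ⟦F⟧ (F′ c₀ e₀′ h′) q r t′ , ⟦W⟧step E′ F′ (k′ q r t′) ⟩A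
        component q r t t′ = ⟨,⟩-cong
          (≈-trans (⟦F⟧-reindex E F false h h″ refl t (ElF-reindex E F false h h″ refl t))
                   (⟦F⟧-cross E F E′ F′ shi h″ h′ (ElF-reindex E F false h h″ refl t) t′))
          (⟦W⟧step-shared E F E′ F′ shσ shi (k q r t) (k′ q r t′))

    ⟦W⟧step-shared : (E : σ ∼ τ) (F : FamOf E i j) (E′ : σ′ ∼ τ′) (F′ : FamOf E′ i′ j′) →
                     ShareEnd σ τ σ′ τ′ → ShareEnd i j i′ j′ → ∀ {c₁ e₁ e₁′ q r r′} →
                     (u : WStep E F c₁ e₁ q r) (v : WStep E′ F′ c₁ e₁′ q r′) →
                     ⟦W⟧step E F u ≈ ⟦W⟧step E′ F′ v
    ⟦W⟧step-shared E F E′ F′ shσ shi (_ , _ , app-c , _ , w) (_ , _ , app-c′ , _ , w′)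
      with App-functional app-c app-c′
    ... | refl = ⟦W⟧-shared E F E′ F′ shσ shi w w′

  ⟦⟧-along-∼ : ∀ {b b′ b″} (D : σ ∼ τ) (Dσ : σ ∼ σ) (Dτ : τ ∼ τ) (hb : El Dσ b b′) (hbτ : El Dτ b b″) →
               ⟦ Dσ ⟧ b b′ hb ≈ ⟦ Dτ ⟧ b b″ hbτ
  ⟦⟧-along-∼ {b = b} D Dσ Dτ hb hbτ =
    ≈-trans (⟦⟧-shared Dσ D (false , false , refl) hb hbD) (⟦⟧-shared D Dτ (true , false , refl) hbD hbτ)
    where
      hbD : El D b b
      hbD = El-to Dσ D (false , false , refl) (El-reflˡ Dσ hb)

  mutual
    ⟦⟧-resp : ∀ (D : σ ∼ τ) {a b a′ b′} → El D a b → (ha : El D a a′) (hb : El D b b′) →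
              ⟦ D ⟧ a a′ ha ≈ ⟦ D ⟧ b b′ hb
    ⟦⟧-resp (∼N _) (_ , _ , ea , eb) (_ , _ , ea′ , _) (_ , _ , eb′ , _)
      with num-injective (trans (sym ea′) (trans ea (trans (sym eb) eb′)))
    ... | refl = ≈-refl _
    ⟦⟧-resp ∼Nω (_ , ea , eb) (_ , ea′ , _) (_ , eb′ , _)
      with num-injective (trans (sym ea′) (trans ea (trans (sym eb) eb′)))
    ... | refl = ≈-refl _
    ⟦⟧-resp (∼Π E F) {f} {g} {f′} {g′} hfg hf hg =
      ≈-pointwise λ { (x , y , h) → refl , refl , component x y h }
      where
        hgg : El (∼Π E F) g g
        hgg = El-reflˡ (∼Π E F) hg
        component : ∀ x y (h : El E x y) →
                    ⟨ ⟦ E ⟧ x y h , ⟦Π⟧ (F x y h) f f′ (hf x y h) ⟩A ≈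
                    ⟨ ⟦ E ⟧ x y h , ⟦Π⟧ (F x y h) g g′ (hg x y h) ⟩A
        component x y h = ⟨,⟩-cong (≈-refl _)
          (≈-trans (⟦Π⟧≈⟦Applied⟧ (F x y h) (hf x y h))
            (≈-trans (⟦Applied⟧-resp (F x y h) (ElΠ-out _ (hf x y h)) (ElΠ-out _ (hg x y h))
                                               (ElΠ-out _ (hfg x y h)) (ElΠ-out _ (hgg x y h)))
              (≈-sym (⟦Π⟧≈⟦Applied⟧ (F x y h) (hg x y h)))))
    ⟦⟧-resp (∼Σ E F) (_ , _ , _ , _ , π₀c , π₁c , π₀d , π₁d , hcd , t)
                     (c₀ , _ , e₀ , _ , π₀c′ , π₁c′ , _ , _ , h , t₁)
                     (d₀ , _ , k₀ , _ , π₀d′ , π₁d′ , _ , _ , h′ , t₂)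
      with App-functional π₀c′ π₀c | App-functional π₁c′ π₁c
         | App-functional π₀d′ π₀d | App-functional π₁d′ π₁d
    ... | refl | refl | refl | refl =
      let hck = El-trans E hcd h′
          t₁′ = ElF-reindex E F false h hck refl (ElF-reflˡ (F c₀ e₀ h) t₁)
          t₂′ = ElF-reindex E F true h′ hck refl (ElF-reflˡ (F d₀ k₀ h′) t₂)
      in ⟨,⟩-cong (⟦⟧-resp E hcd h h′)
           (≈-trans (⟦F⟧-reindex E F false h hck refl t₁ t₁′)
             (≈-trans (⟦F⟧-resp (F c₀ k₀ hck) (ElF-reindex E F false hcd hck refl t) t₁′ t₂′)
               (≈-sym (⟦F⟧-reindex E F true h′ hck refl t₂ t₂′))))
    ⟦⟧-resp (∼I _ _ _) _ _ _ = ≈-refl _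
    ⟦⟧-resp (∼W _ E F) r ha hb = ⟦W⟧-resp E F ha hb r

    ⟦F⟧-resp : ∀ {a b} (φ : Fam i j a b) {x y x′ y′} → ElF φ x y → (t : ElF φ x x′) (t′ : ElF φ y y′) →
               ⟦F⟧ φ x x′ t ≈ ⟦F⟧ φ y y′ t′
    ⟦F⟧-resp (fam _ _ _ _ T) = ⟦⟧-resp T

    ⟦Applied⟧-resp : ∀ {a b f f′ g g′} (φ : Fam i j a b) (u : Applied φ f f′) (v : Applied φ g g′) →
                     Applied φ f g → Applied φ g g → ⟦Applied⟧ φ u ≈ ⟦Applied⟧ φ v
    ⟦Applied⟧-resp φ (_ , _ , app-f , _ , t) (_ , _ , app-g , _ , t′)
                     (_ , _ , app-f′ , app-g′ , tfg) (_ , _ , app-g″ , app-g‴ , tgg)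
      with App-functional app-f app-f′ | App-functional app-g app-g″ | App-functional app-g′ app-g‴
    ... | refl | refl | refl = ⟦F⟧-resp φ (ElF-trans φ tfg (ElF-sym φ tgg)) t t′

    ⟦W⟧-resp : (E : σ ∼ τ) (F : FamOf E i j) → ∀ {c e c′ e′} →
               (w : WRel E F c e) (w′ : WRel E F c′ e′) →
               WRel E F c c′ → ⟦W⟧ E F w ≈ ⟦W⟧ E F w′
    ⟦W⟧-resp E F (wsup c₀ _ e₀ _ π₀c π₁c _ _ h k) (wsup c₀′ _ e₀′ _ π₀c′ π₁c′ _ _ h′ k′)
                 (wsup _ _ _ _ π₀c″ π₁c″ π₀c‴ π₁c‴ hr kr)
      with App-functional π₀c π₀c″ | App-functional π₁c π₁c″
         | App-functional π₀c′ π₀c‴ | App-functional π₁c′ π₁c‴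
    ... | refl | refl | refl | refl =
      ⟨,⟩-cong (⟦⟧-resp E hr h h′) (≈-sup-⇔ forth back λ q r t t′ → refl , refl , component q r t t′)
      where
        hce : El E c₀ e₀′
        hce = El-trans E hr h′
        forth : ∀ {q r} → ElF (F c₀ e₀ h) q r → ElF (F c₀′ e₀′ h′) q r
        forth t = ElF-reindex E F true hce h′ refl (ElF-reindex E F false h hce refl t)
        back : ∀ {q r} → ElF (F c₀′ e₀′ h′) q r → ElF (F c₀ e₀ h) q r
        back t′ = ElF-reindex E F false hce h refl (ElF-reindex E F true h′ hce refl t′)
        component : ∀ q r (t : ElF (F c₀ e₀ h) q r) (t′ : ElF (F c₀′ e₀′ h′) q r) →
                    ⟨ ⟦F⟧ (F c₀ e₀ h) q r t , ⟦W⟧step E F (k q r t) ⟩A ≈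
                    ⟨ ⟦F⟧ (F c₀′ e₀′ h′) q r t′ , ⟦W⟧step E F (k′ q r t′) ⟩A
        component q r t t′ = ⟨,⟩-cong
          (≈-trans (⟦F⟧-reindex E F false h hce refl t (ElF-reindex E F false h hce refl t))
                   (≈-sym (⟦F⟧-reindex E F true h′ hce refl t′ (ElF-reindex E F false h hce refl t))))
          (⟦W⟧step-resp E F (k q r t) (k′ q r t′)
             (kr q q (ElF-reindex E F false h hr refl (ElF-reflˡ (F c₀ e₀ h) t))))

    ⟦W⟧step-resp : (E : σ ∼ τ) (F : FamOf E i j) → ∀ {c₁ e₁ c₁′ e₁′ q r r′} →
                   (u : WStep E F c₁ e₁ q r) (v : WStep E F c₁′ e₁′ q r′) → WStep E F c₁ c₁′ q q →
                   ⟦W⟧step E F u ≈ ⟦W⟧step E F v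
    ⟦W⟧step-resp E F (_ , _ , app-c , _ , w) (_ , _ , app-c′ , _ , w′) (_ , _ , app-c″ , app-c‴ , wr)
      with App-functional app-c app-c″ | App-functional app-c′ app-c‴
    ... | refl | refl = ⟦W⟧-resp E F w w′ wr

  mutual
    ≅⇒El : ∀ (D : σ ∼ τ) {a a′ b b′} (ha : El D a a′) (hb : El D b b′) →
           ⟦ D ⟧ a a′ ha ≅ ⟦ D ⟧ b b′ hb → El D a b
    ≅⇒El (∼N _) (m , m<n , ea , _) (m′ , _ , eb , _) e with dot-injective {m} {m′} e
    ... | refl = m , m<n , ea , eb
    ≅⇒El ∼Nω (m , ea , _) (m′ , eb , _) e with dot-injective {m} {m′} e
    ... | refl = m , ea , eb
    ≅⇒El (∼Π E F) hf hg e x y h =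
      let ((x′ , y′ , h′) , e-elt) = proj₁ e (x , y , h)
          (ex , e-val) = ⟨,⟩-injective e-elt
          hxx′ = ≅⇒El E h h′ ex
          hx′y = El-trans E (El-sym E hxx′) h
          hgg = El-reflˡ (∼Π E F) hg
      in ≅⇒ElΠ E F h h′ hxx′ (ElΠ-out (F x y h) (hf x y h)) (ElΠ-out (F x′ y′ h′) (hg x′ y′ h′))
           (ElΠ-out (F x′ y hx′y) (hgg x′ y hx′y))
           (≅-trans (≈⇒≅ (≈-sym (⟦Π⟧≈⟦Applied⟧ (F x y h) (hf x y h))))
             (≅-trans e-val (≈⇒≅ (⟦Π⟧≈⟦Applied⟧ (F x′ y′ h′) (hg x′ y′ h′)))))
    ≅⇒El (∼Σ E F) (c₀ , c₁ , e₀ , _ , π₀c , π₁c , _ , _ , h , t)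
                  (d₀ , d₁ , k₀ , _ , π₀d , π₁d , _ , _ , h′ , t′) e =
      let (e₀≅ , e₁≅) = ⟨,⟩-injective e
          hcd = ≅⇒El E h h′ e₀≅
          hdd = El-reflˡ E h′
          tc = ElF-reindex E F false h hcd refl (ElF-reflˡ (F c₀ e₀ h) t)
          td = ElF-reindex E F false h′ hdd refl (ElF-reflˡ (F d₀ k₀ h′) t′)
          td′ = ElF-reindex E F true hdd hcd refl td
      in c₀ , c₁ , d₀ , d₁ , π₀c , π₁c , π₀d , π₁d , hcd ,
         ≅⇒ElF (F c₀ d₀ hcd) tc td′
           (≅-trans (≈⇒≅ (≈-sym (⟦F⟧-reindex E F false h hcd refl t tc)))
             (≅-trans e₁≅ (≈⇒≅ (≈-trans (⟦F⟧-reindex E F false h′ hdd refl t′ td)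
                                        (⟦F⟧-reindex E F true hdd hcd refl td td′)))))
    ≅⇒El (∼I _ _ _) (c≡𝟎 , _ , hab) (d≡𝟎 , _ , _) _ = c≡𝟎 , d≡𝟎 , hab
    ≅⇒El (∼W _ E F) ha hb e = ≅⇒W E F ha hb e

    ≅⇒ElF : ∀ {a b} (φ : Fam i j a b) {x x′ y y′} (t : ElF φ x x′) (t′ : ElF φ y y′) →
            ⟦F⟧ φ x x′ t ≅ ⟦F⟧ φ y y′ t′ → ElF φ x y
    ≅⇒ElF (fam _ _ _ _ T) = ≅⇒El T

    -- The element at x of the graph of f matches one at some x′ ∼ x in that of g: f x ∼ g x′ ∼ g y.
    ≅⇒ElΠ : ∀ (E : σ ∼ τ) (F : FamOf E i j) {x y x′ y′ f f′ g g′} (h : El E x y) (h′ : El E x′ y′)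
            (hxx′ : El E x x′) (u : Applied (F x y h) f f′) (v : Applied (F x′ y′ h′) g g′)
            (w : Applied (F x′ y (El-trans E (El-sym E hxx′) h)) g g) →
            ⟦Applied⟧ (F x y h) u ≅ ⟦Applied⟧ (F x′ y′ h′) v → ElΠ (F x y h) f g
    ≅⇒ElΠ E F {x} {y} {x′} {y′} h h′ hxx′
      (fx , _ , app-f , _ , tu) (_ , _ , app-g , _ , tv) (_ , gy , app-g′ , app-gy , tw) e
      with App-functional app-g app-g′
    ... | refl =
      let hxy′ = El-trans E hxx′ h′
          hx′y = El-trans E (El-sym E hxx′) h
          tv′ = ElF-reindex E F true h′ hxy′ refl tv
          tv″ = ElF-reindex E F false hxy′ h refl tv′
          fx∼gx′ = ≅⇒ElF (F x y h) tu tv″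
                     (≅-trans e (≈⇒≅ (≈-trans (⟦F⟧-reindex E F true h′ hxy′ refl tv tv′)
                                              (⟦F⟧-reindex E F false hxy′ h refl tv′ tv″))))
      in ElΠ-in (F x y h) (fx , gy , app-f , app-gy ,
           ElF-trans (F x y h) fx∼gx′ (ElF-reindex E F true hx′y h refl tw))

    ≅⇒W : (E : σ ∼ τ) (F : FamOf E i j) → ∀ {c e c′ e′} →
          (w : WRel E F c e) (w′ : WRel E F c′ e′) →
          ⟦W⟧ E F w ≅ ⟦W⟧ E F w′ → WRel E F c c′
    ≅⇒W E F (wsup c₀ c₁ e₀ _ π₀c π₁c _ _ h k) (wsup d₀ d₁ k₀ _ π₀d π₁d _ _ h′ k′) e =
      let (e₀≅ , e₁≅) = ⟨,⟩-injective e
          hcd = ≅⇒El E h h′ e₀≅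
          hdd = El-reflˡ E h′
      in wsup c₀ c₁ d₀ d₁ π₀c π₁c π₀d π₁d hcd λ q r t →
        let tq = ElF-reindex E F false hcd h refl (ElF-reflˡ (F c₀ d₀ hcd) t)
            ((q′ , r′ , t′) , e-elt) = proj₁ e₁≅ (q , q , tq)
            (eq≅ , estep≅) = ⟨,⟩-injective e-elt
            td = ElF-reindex E F false h′ hdd refl (ElF-reflˡ (F d₀ k₀ h′) t′)
            td′ = ElF-reindex E F true hdd hcd refl td
            q∼q′ = ≅⇒ElF (F c₀ d₀ hcd) (ElF-reflˡ (F c₀ d₀ hcd) t) td′
                     (≅-trans (≈⇒≅ (⟦F⟧-reindex E F false hcd h refl (ElF-reflˡ (F c₀ d₀ hcd) t) tq))
                       (≅-trans eq≅ (≈⇒≅ (≈-trans (⟦F⟧-reindex E F false h′ hdd refl t′ td)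
                                                  (⟦F⟧-reindex E F true hdd hcd refl td td′)))))
            q′∼r = ElF-trans (F c₀ d₀ hcd) (ElF-sym (F c₀ d₀ hcd) q∼q′) t
            at-d : ∀ {u v} → ElF (F c₀ d₀ hcd) u v → ElF (F d₀ k₀ h′) u v
            at-d t″ = ElF-reindex E F false hdd h′ refl (ElF-reindex E F true hcd hdd refl t″)
        in ≅⇒WStep E F (k q q tq) (k′ q′ r′ t′) (k′ q′ r (at-d q′∼r))
             (k′ r r (at-d (ElF-reflʳ (F c₀ d₀ hcd) t))) estep≅

    -- d₁ q′ is matched against c₁ q; the W-relation then carries it over to d₁ r.
    ≅⇒WStep : (E : σ ∼ τ) (F : FamOf E i j) → ∀ {c₁ e₁ d₁ k₁ q r q′ r′} →
              (u : WStep E F c₁ e₁ q q) (v : WStep E F d₁ k₁ q′ r′) →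
              WStep E F d₁ k₁ q′ r → WStep E F d₁ k₁ r r →
              ⟦W⟧step E F u ≅ ⟦W⟧step E F v → WStep E F c₁ d₁ q r
    ≅⇒WStep E F (cq , _ , app-c , _ , wc) (_ , _ , app-d , _ , wd) (_ , _ , app-d′ , app-k , wq′r)
                (dr , _ , app-dr , app-k′ , wrr) e
      with App-functional app-d app-d′ | App-functional app-k app-k′
    ... | refl | refl =
      cq , dr , app-c , app-dr , W-trans E F (≅⇒W E F wc wd e) (W-trans E F wq′r (W-sym E F wrr))

  realized-equality⇒∼ : ∀ {a b} (D : σ ∼ τ) (Dσ : σ ∼ σ) (Dτ : τ ∼ τ)
    (ha : El Dσ a a) (hb : El Dσ b b) (hbτ : El Dτ b b) →
    Σ A (λ c → Σ A (λ d → Realize-eq c d (⟦ Dσ ⟧ a a ha) (⟦ Dτ ⟧ b b hbτ))) → El Dσ a b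
  realized-equality⇒∼ D Dσ Dτ ha hb hbτ (_ , _ , r) =
    ≅⇒El Dσ ha hb (≅-trans (Realize-eq⇒≅ _ _ r) (≈⇒≅ (≈-sym (⟦⟧-along-∼ D Dσ Dτ hb hbτ))))

  ∼⇒⟦⟧-equal : ∀ {a b} (D : σ ∼ τ) (Dσ : σ ∼ σ) (Dτ : τ ∼ τ)
    (ha : El Dσ a a) (hb : El Dσ b b) (hbτ : El Dτ b b) → El Dσ a b → ⟦ Dσ ⟧ a a ha ≈ ⟦ Dτ ⟧ b b hbτ
  ∼⇒⟦⟧-equal D Dσ Dτ ha hb hbτ hab = ≈-trans (⟦⟧-resp Dσ hab ha hb) (⟦⟧-along-∼ D Dσ Dτ hb hbτ)

lemma4p11 : (P : PAS) (C : PCA P) (withW : Bool) →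
    let open TS P C withW in
    ∀ {σ τ a b : A} (D : σ ∼ τ) (Dσ : σ ∼ σ) (Dτ : τ ∼ τ)
      (ha : El Dσ a a) (hb : El Dσ b b) (hbτ : El Dτ b b) →
      ((Σ A (λ c → Σ A (λ d → Realize-eq c d (⟦ Dσ ⟧ a a ha) (⟦ Dτ ⟧ b b hbτ)))) → El Dσ a b)
      × (El Dσ a b → ⟦ Dσ ⟧ a a ha ≈ ⟦ Dτ ⟧ b b hbτ)
lemma4p11 P C withW D Dσ Dτ ha hb hbτ =
  realized-equality⇒∼ P C withW D Dσ Dτ ha hb hbτ , ∼⇒⟦⟧-equal P C withW D Dσ Dτ ha hb hbτ
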